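{- Let $d\geqslant 2$ and let $\mathcal{D}=\{(\varepsilon_1 n,\dots,\varepsilon_d n)\in\mathbb{Z}^d : n\in\mathbb{Z},\ \varepsilon_1,\dots,\varepsilon_d\in\{1,-1\}\}$. Then $\mathcal{D}$ is not eventually periodic (for any choice of periods). Moreover, for each $1\leqslant i\leqslant d$, the set $\mathcal{H}_i=\{(x_1,\dots,x_d)\in\mathbb{Z}^d : x_i=0\}$ is a minimal complement of $\mathcal{D}$ in $\mathbb{Z}^d$.
   Context: $\mathbb{N}=\{0,1,2,\dots\}$. For $u_1,\dots,u_d\in\mathbb{Z}^d$ with no nontrivial $\mathbb{Z}$-linear relation, let $P=\mathbb{N}u_1+\cdots+\mathbb{N}u_d$; a nonempty $X\subseteq\mathbb{Z}^d$ is eventually periodic with periods $u_1,\dots,u_d$ if $X\subseteq F+P$ for some nonempty finite $F\subseteq\mathbb{Z}^d$ and $x+P\subseteq X$ for all but finitely many $x\in X$; it is eventually periodic if it is so for some such $u_1,\dots,u_d$. A complement of $\mathcal{D}$ is a nonempty $M\subseteq\mathbb{Z}^d$ with $M+\mathcal{D}=\mathbb{Z}^d$; it is minimal if no proper subset of $M$ is a complement. -}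

module Defs where

open import Data.Nat using (ℕ; _≥_)
import Data.Nat as ℕ
open import Data.Integer using (ℤ; +_; _+_; _*_; -_; 0ℤ; 1ℤ)
open import Data.Fin using (Fin; zero; suc)
open import Data.Vec using (Vec; zipWith; map; replicate; lookup; foldr)
open import Data.List using (List; _∷_)
open import Data.List.Membership.Propositional using (_∈_)
open import Data.Product using (Σ; ∃; _×_; _,_)
open import Data.Sum using (_⊎_)
open import Relation.Binary.PropositionalEquality using (_≡_)
open import Relation.Nullary using (¬_)

ℤ^ : ℕ → Set
ℤ^ d = Vec ℤ d

Subset : ℕ → Set₁
Subset d = ℤ^ d → Set

_⊕_ : ∀ {d} → ℤ^ d → ℤ^ d → ℤ^ d
_⊕_ = zipWith _+_

zero^ : ∀ {d} → ℤ^ d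
zero^ = replicate _ 0ℤ

_·_ : ∀ {d} → ℤ → ℤ^ d → ℤ^ d
c · v = map (c *_) v

sumFin : ∀ {d} (n : ℕ) → (Fin n → ℤ^ d) → ℤ^ d
sumFin ℕ.zero f = zero^
sumFin (ℕ.suc n) f = f zero ⊕ sumFin n (λ i → f (suc i))

lincomb : ∀ {d} → (Fin d → ℤ) → (Fin d → ℤ^ d) → ℤ^ d
lincomb {d} c u = sumFin d (λ i → c i · u i)

ZIndependent : ∀ {d} → (Fin d → ℤ^ d) → Set
ZIndependent {d} u = ∀ (c : Fin d → ℤ) → lincomb c u ≡ zero^ → ∀ i → c i ≡ 0ℤ

InCone : ∀ {d} → (Fin d → ℤ^ d) → Subset d
InCone {d} u x = Σ (Fin d → ℕ) λ k → x ≡ lincomb (λ i → + k i) u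

_⊆_ : ∀ {d} → Subset d → Subset d → Set
X ⊆ Y = ∀ x → X x → Y x

Nonempty : ∀ {d} → Subset d → Set
Nonempty {d} X = Σ (ℤ^ d) X

EventuallyPeriodicWith : ∀ {d} → Subset d → (Fin d → ℤ^ d) → Set
EventuallyPeriodicWith {d} X u =
  Nonempty X ×
  (Σ (ℤ^ d) λ f₀ → Σ (List (ℤ^ d)) λ fs →
     ∀ x → X x → Σ (ℤ^ d) λ f → Σ (ℤ^ d) λ p →
       (f ∈ (f₀ ∷ fs)) × InCone u p × (x ≡ f ⊕ p)) ×
  (Σ (List (ℤ^ d)) λ E →
     ∀ x → X x → ¬ (x ∈ E) → ∀ p → InCone u p → X (x ⊕ p))

EventuallyPeriodic : ∀ {d} → Subset d → Set
EventuallyPeriodic {d} X =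
  Σ (Fin d → ℤ^ d) λ u → ZIndependent u × EventuallyPeriodicWith X u

IsComplement : ∀ {d} → Subset d → Subset d → Set
IsComplement {d} M D =
  Nonempty M × (∀ z → Σ (ℤ^ d) λ m → Σ (ℤ^ d) λ δ → M m × D δ × (z ≡ m ⊕ δ))

IsMinimalComplement : ∀ {d} → Subset d → Subset d → Set₁
IsMinimalComplement {d} M D =
  IsComplement M D ×
  (∀ (M' : Subset d) → M' ⊆ M → (Σ (ℤ^ d) λ x → M x × ¬ M' x) → ¬ IsComplement M' D)

data Sign : Set where
  pos neg : Sign

signVal : Sign → ℤ
signVal pos = 1ℤ
signVal neg = - 1ℤ

Diag : (d : ℕ) → Subset d
Diag d x = Σ ℤ λ n → Σ (Vec Sign d) λ ε → x ≡ map (λ e → signVal e * n) ε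

Hyper : (d : ℕ) → Fin d → Subset d
Hyper d i x = lookup x i ≡ 0ℤ

-- A point of 𝒟 has all coordinates of the same absolute value. If c·𝟙 + v and c·𝟙 + 2v both lie
-- in 𝒟 with c ≠ 0, then v is constant: a coordinate pair with v_j ≠ v_k would need
-- c + v_j = −(c + v_k) and c + 2v_j = −(c + 2v_k), forcing c = 0. If 𝒟 were eventually periodic,
-- a point c·𝟙 ∈ 𝒟 outside the finite exceptional set gives c·𝟙 + u_i, c·𝟙 + 2u_i ∈ 𝒟, so every
-- period u_i is a multiple of 𝟙, and two such periods are ℤ-dependent.
-- For ℋ_i: z = (z − z_i·𝟙) + z_i·𝟙 covers ℤ^d, and a point of 𝒟 with a zero coordinate is 0,
-- so the only way to cover x ∈ ℋ_i from a subset of ℋ_i is with x itself.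
module Submission where

open import Defs
open import Data.Nat using (ℕ; _≥_; s≤s)
import Data.Nat as ℕ
import Data.Nat.Properties as ℕP
open import Data.Integer using (ℤ; +_; _+_; _*_; -_; _-_; 0ℤ; 1ℤ; ∣_∣)
import Data.Integer.Properties as ℤP
open import Algebra.Properties.AbelianGroup ℤP.+-0-abelianGroup using (∙-cancelˡ)
open import Data.Integer.Tactic.RingSolver using (solve-∀)
open import Data.Fin using (Fin; zero; suc; _≟_)
open import Data.Fin.Properties using (suc-injective)
open import Data.Vec using (Vec; zipWith; replicate; lookup; head; tabulate)
open import Data.Vec.Properties
  using (lookup-map; lookup-zipWith; lookup-replicate; map-replicate; tabulate∘lookup; tabulate-cong)
open import Data.List using (List)
import Data.List as List
open import Data.List.Membership.Propositional using (_∉_)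
open import Data.List.Membership.Propositional.Properties using (∈-map⁺)
import Data.List.Relation.Unary.All as All
open import Data.List.Extrema.Nat using (max; xs≤max)
open import Data.Bool using (if_then_else_)
open import Data.Product using (Σ; _×_; _,_; proj₁; proj₂)
open import Data.Sum using (_⊎_; inj₁; inj₂; [_,_]′)
open import Function using (id; _∘_)
open import Relation.Binary.PropositionalEquality
open import Relation.Nullary using (¬_; does; contradiction)
open import Relation.Nullary.Decidable using (dec-true; dec-false)

private
  variable
    d d' : ℕ

lookup-ext : ∀ {A : Set} {n} {xs ys : Vec A n} → (∀ j → lookup xs j ≡ lookup ys j) → xs ≡ ys
lookup-ext {xs = xs} {ys} eq = begin
  xs                   ≡⟨ tabulate∘lookup xs ⟨
  tabulate (lookup xs) ≡⟨ tabulate-cong eq ⟩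
  tabulate (lookup ys) ≡⟨ tabulate∘lookup ys ⟩
  ys                   ∎
  where open ≡-Reasoning

lookup-⊕ : ∀ (v w : ℤ^ d) j → lookup (v ⊕ w) j ≡ lookup v j + lookup w j
lookup-⊕ v w j = lookup-zipWith _+_ j v w

lookup-· : ∀ c (v : ℤ^ d) j → lookup (c · v) j ≡ c * lookup v j
lookup-· c v j = lookup-map j (c *_) v

lookup-zero^ : ∀ (j : Fin d) → lookup (zero^ {d}) j ≡ 0ℤ
lookup-zero^ {d} j = lookup-replicate j 0ℤ

⊕-identityˡ : ∀ (v : ℤ^ d) → zero^ ⊕ v ≡ v
⊕-identityˡ v = lookup-ext λ j →
  trans (lookup-⊕ zero^ v j) (trans (cong (_+ lookup v j) (lookup-zero^ j)) (ℤP.+-identityˡ _))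

⊕-identityʳ : ∀ (v : ℤ^ d) → v ⊕ zero^ ≡ v
⊕-identityʳ v = lookup-ext λ j →
  trans (lookup-⊕ v zero^ j) (trans (cong (λ t → lookup v j + t) (lookup-zero^ j)) (ℤP.+-identityʳ _))

·-zeroˡ : ∀ (v : ℤ^ d) → 0ℤ · v ≡ zero^
·-zeroˡ v = lookup-ext λ j → trans (lookup-· 0ℤ v j) (sym (lookup-zero^ j))

sumFin-zero : ∀ n (f : Fin n → ℤ^ d) → (∀ j → f j ≡ zero^) → sumFin n f ≡ zero^
sumFin-zero ℕ.zero    f f≡0 = refl
sumFin-zero (ℕ.suc n) f f≡0 = begin
  f zero ⊕ sumFin n (f ∘ suc) ≡⟨ cong₂ _⊕_ (f≡0 zero) (sumFin-zero n (f ∘ suc) (f≡0 ∘ suc)) ⟩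
  zero^ ⊕ zero^               ≡⟨ ⊕-identityˡ zero^ ⟩
  zero^                       ∎
  where open ≡-Reasoning

sumFin-single : ∀ n (f : Fin n → ℤ^ d) i → (∀ j → j ≢ i → f j ≡ zero^) → sumFin n f ≡ f i
sumFin-single (ℕ.suc n) f zero f≡0 = begin
  f zero ⊕ sumFin n (f ∘ suc) ≡⟨ cong (f zero ⊕_) (sumFin-zero n (f ∘ suc) (λ j → f≡0 (suc j) λ ())) ⟩
  f zero ⊕ zero^              ≡⟨ ⊕-identityʳ (f zero) ⟩
  f zero                      ∎
  where open ≡-Reasoning
sumFin-single (ℕ.suc n) f (suc i) f≡0 = begin
  f zero ⊕ sumFin n (f ∘ suc) ≡⟨ cong (_⊕ sumFin n (f ∘ suc)) (f≡0 zero λ ()) ⟩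
  zero^ ⊕ sumFin n (f ∘ suc)  ≡⟨ ⊕-identityˡ _ ⟩
  sumFin n (f ∘ suc)          ≡⟨ sumFin-single n (f ∘ suc) i (λ j → f≡0 (suc j) ∘ (_∘ suc-injective)) ⟩
  f (suc i)                   ∎
  where open ≡-Reasoning

·-generator-∈-cone : ∀ (u : Fin d → ℤ^ d) i k → InCone u ((+ k) · u i)
·-generator-∈-cone {d} u i k = coeff , sym (trans (sumFin-single d _ i vanishes-off-i) at-i)
  where
  coeff : Fin d → ℕ
  coeff j = if does (j ≟ i) then k else 0
  at-i : (+ coeff i) · u i ≡ (+ k) · u i
  at-i = cong (λ b → (+ (if b then k else 0)) · u i) (dec-true (i ≟ i) refl)
  vanishes-off-i : ∀ j → j ≢ i → (+ coeff j) · u j ≡ zero^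
  vanishes-off-i j j≢i =
    trans (cong (λ b → (+ (if b then k else 0)) · u j) (dec-false (j ≟ i) j≢i)) (·-zeroˡ (u j))

_⊖_ : ℤ^ d → ℤ^ d → ℤ^ d
_⊖_ = zipWith _-_

lookup-⊖ : ∀ (v w : ℤ^ d) j → lookup (v ⊖ w) j ≡ lookup v j - lookup w j
lookup-⊖ v w j = lookup-zipWith _-_ j v w

⊖-⊕-cancel : ∀ (v w : ℤ^ d) → (v ⊖ w) ⊕ w ≡ v
⊖-⊕-cancel v w = lookup-ext λ j → begin
  lookup ((v ⊖ w) ⊕ w) j               ≡⟨ lookup-⊕ (v ⊖ w) w j ⟩
  lookup (v ⊖ w) j + lookup w j        ≡⟨ cong (_+ lookup w j) (lookup-⊖ v w j) ⟩
  lookup v j - lookup w j + lookup w j ≡⟨ minus-plus (lookup v j) (lookup w j) ⟩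
  lookup v j                           ∎
  where
  open ≡-Reasoning
  minus-plus : ∀ a b → a - b + b ≡ a
  minus-plus = solve-∀

infix 4 _≡±_
_≡±_ : ℤ → ℤ → Set
a ≡± b = a ≡ b ⊎ a ≡ - b

signVal-≡± : ∀ s t n → signVal s * n ≡± signVal t * n
signVal-≡± pos pos n = inj₁ refl
signVal-≡± neg neg n = inj₁ refl
signVal-≡± pos neg n = inj₂ (pos-neg n)
  where
  pos-neg : ∀ n → 1ℤ * n ≡ - (- 1ℤ * n)
  pos-neg = solve-∀
signVal-≡± neg pos n = inj₂ (neg-pos n)
  where
  neg-pos : ∀ n → - 1ℤ * n ≡ - (1ℤ * n)
  neg-pos = solve-∀

Diag-lookup-≡± : ∀ {δ} → Diag d δ → ∀ j k → lookup δ j ≡± lookup δ k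
Diag-lookup-≡± (n , ε , refl) j k = subst₂ _≡±_ (sym (lookup-map j _ ε)) (sym (lookup-map k _ ε))
  (signVal-≡± (lookup ε j) (lookup ε k) n)

Diag-replicate : ∀ d c → Diag d (replicate d c)
Diag-replicate d c =
  c , replicate d pos , sym (trans (map-replicate _ pos d) (cong (replicate d) (ℤP.*-identityˡ c)))

Diag-lookup≡0⇒≡zero^ : ∀ {δ} i → Diag d δ → lookup δ i ≡ 0ℤ → δ ≡ zero^
Diag-lookup≡0⇒≡zero^ {δ = δ} i δ∈𝒟 δᵢ≡0 =
  lookup-ext λ j → trans (vanishes (Diag-lookup-≡± δ∈𝒟 j i)) (sym (lookup-zero^ j))
  where
  vanishes : ∀ {a} → a ≡± lookup δ i → a ≡ 0ℤ
  vanishes (inj₁ a≡δᵢ) = trans a≡δᵢ δᵢ≡0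
  vanishes (inj₂ a≡-δᵢ) = trans a≡-δᵢ (cong -_ δᵢ≡0)

translate-cancel : ∀ k .{{_ : ℕ.NonZero k}} c a b → c + (+ k) * a ≡ c + (+ k) * b → a ≡ b
translate-cancel k c a b eq = ℤP.*-cancelˡ-≡ (+ k) a b (∙-cancelˡ c _ _ eq)

translate-doubling-rigid : ∀ {c a b} → c ≢ 0ℤ →
  c + (+ 1) * a ≡± c + (+ 1) * b → c + (+ 2) * a ≡± c + (+ 2) * b → a ≡ b
translate-doubling-rigid {c} {a} {b} _   (inj₁ eq₁) _          = translate-cancel 1 c a b eq₁
translate-doubling-rigid {c} {a} {b} _   (inj₂ _)   (inj₁ eq₂) = translate-cancel 2 c a b eq₂
-- c = 2(c + a) − (c + 2a), and the same combination for b gives c too, so flipping both signs gives −c.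
translate-doubling-rigid {c} {a} {b} c≢0 (inj₂ eq₁) (inj₂ eq₂) =
  contradiction ([ (λ ()) , id ]′ (ℤP.i*j≡0⇒i≡0∨j≡0 (+ 2) 2c≡0)) c≢0
  where
  open ≡-Reasoning
  recombine : ∀ c a b → (+ 2) * c ≡
    (+ 2) * (c + (+ 1) * a) - (c + (+ 2) * a) + ((+ 2) * (c + (+ 1) * b) - (c + (+ 2) * b))
  recombine = solve-∀
  cancels : ∀ p q → (+ 2) * - p - - q + ((+ 2) * p - q) ≡ 0ℤ
  cancels = solve-∀
  2c≡0 : (+ 2) * c ≡ 0ℤ
  2c≡0 = begin
    (+ 2) * c
      ≡⟨ recombine c a b ⟩
    (+ 2) * (c + (+ 1) * a) - (c + (+ 2) * a) + ((+ 2) * (c + (+ 1) * b) - (c + (+ 2) * b))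
      ≡⟨ cong₂ (λ p q → (+ 2) * p - q + ((+ 2) * (c + (+ 1) * b) - (c + (+ 2) * b))) eq₁ eq₂ ⟩
    (+ 2) * - (c + (+ 1) * b) - - (c + (+ 2) * b) + ((+ 2) * (c + (+ 1) * b) - (c + (+ 2) * b))
      ≡⟨ cancels (c + (+ 1) * b) (c + (+ 2) * b) ⟩
    0ℤ ∎

IsConstant : ℤ^ d → Set
IsConstant v = ∀ j k → lookup v j ≡ lookup v k

Diag-translate-rigid : ∀ c (v : ℤ^ d) → c ≢ 0ℤ →
  Diag d (replicate d c ⊕ ((+ 1) · v)) → Diag d (replicate d c ⊕ ((+ 2) · v)) → IsConstant v
Diag-translate-rigid {d} c v c≢0 on₁ on₂ j k =
  translate-doubling-rigid c≢0 (coordinates (+ 1) on₁) (coordinates (+ 2) on₂)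
  where
  lookup-translate : ∀ a j → lookup (replicate d c ⊕ (a · v)) j ≡ c + a * lookup v j
  lookup-translate a j =
    trans (lookup-⊕ (replicate d c) (a · v) j) (cong₂ _+_ (lookup-replicate j c) (lookup-· a v j))
  coordinates : ∀ a → Diag d (replicate d c ⊕ (a · v)) → c + a * lookup v j ≡± c + a * lookup v k
  coordinates a on = subst₂ _≡±_ (lookup-translate a j) (lookup-translate a k) (Diag-lookup-≡± on j k)

∃-replicate-∉ : (E : List (ℤ^ (ℕ.suc d))) → Σ ℕ λ n → replicate (ℕ.suc d) (+ ℕ.suc n) ∉ E
∃-replicate-∉ E = bound , λ r∈E →
  ℕP.n≮n bound (All.lookup (xs≤max 0 heads) (∈-map⁺ (∣_∣ ∘ head) r∈E))
  where
  heads : List ℕ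
  heads = List.map (∣_∣ ∘ head) E
  bound : ℕ
  bound = max 0 heads

module _ (u : Fin (ℕ.suc (ℕ.suc d')) → ℤ^ (ℕ.suc (ℕ.suc d'))) where

  lincomb-first-two : ∀ c → (∀ i → c (suc (suc i)) ≡ 0ℤ) →
    lincomb c u ≡ (c zero · u zero) ⊕ (c (suc zero) · u (suc zero))
  lincomb-first-two c c≡0 = cong ((c zero · u zero) ⊕_) (begin
    (c (suc zero) · u (suc zero)) ⊕ sumFin d' (λ i → c (suc (suc i)) · u (suc (suc i)))
      ≡⟨ cong ((c (suc zero) · u (suc zero)) ⊕_) (sumFin-zero d' _ λ i →
           trans (cong (_· u (suc (suc i))) (c≡0 i)) (·-zeroˡ _)) ⟩
    (c (suc zero) · u (suc zero)) ⊕ zero^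
      ≡⟨ ⊕-identityʳ _ ⟩
    c (suc zero) · u (suc zero) ∎)
    where open ≡-Reasoning

  relation-first-two : ∀ c → (∀ i → c (suc (suc i)) ≡ 0ℤ) →
    (∀ j → c zero * lookup (u zero) j + c (suc zero) * lookup (u (suc zero)) j ≡ 0ℤ) →
    lincomb c u ≡ zero^
  relation-first-two c c≡0 vanishes = begin
    lincomb c u                                             ≡⟨ lincomb-first-two c c≡0 ⟩
    (c zero · u zero) ⊕ (c (suc zero) · u (suc zero))       ≡⟨ lookup-ext coordinates ⟩
    zero^                                                   ∎
    where
    open ≡-Reasoning
    coordinates : ∀ j → lookup ((c zero · u zero) ⊕ (c (suc zero) · u (suc zero))) j ≡ lookup zero^ j
    coordinates j = begin
      lookup ((c zero · u zero) ⊕ (c (suc zero) · u (suc zero))) j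
        ≡⟨ lookup-⊕ (c zero · u zero) (c (suc zero) · u (suc zero)) j ⟩
      lookup (c zero · u zero) j + lookup (c (suc zero) · u (suc zero)) j
        ≡⟨ cong₂ _+_ (lookup-· (c zero) (u zero) j) (lookup-· (c (suc zero)) (u (suc zero)) j) ⟩
      c zero * lookup (u zero) j + c (suc zero) * lookup (u (suc zero)) j
        ≡⟨ vanishes j ⟩
      0ℤ
        ≡⟨ lookup-zero^ j ⟨
      lookup zero^ j ∎

  constant-generators-dependent : IsConstant (u zero) → IsConstant (u (suc zero)) → ¬ ZIndependent u
  constant-generators-dependent u₀-const u₁-const independent =
    contradiction (independent first first-relation zero) λ ()
    where
    a₀ a₁ : ℤ
    a₀ = lookup (u zero) zero
    a₁ = lookup (u (suc zero)) zero
    cross : Fin (ℕ.suc (ℕ.suc d')) → ℤ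
    cross zero = a₁
    cross (suc zero) = - a₀
    cross (suc (suc _)) = 0ℤ
    cross-cancels : ∀ x y → x * y + - y * x ≡ 0ℤ
    cross-cancels = solve-∀
    cross-relation : lincomb cross u ≡ zero^
    cross-relation = relation-first-two cross (λ _ → refl) λ j →
      trans (cong₂ (λ x y → a₁ * x + - a₀ * y) (u₀-const j zero) (u₁-const j zero)) (cross-cancels a₁ a₀)
    a₀≡0 : a₀ ≡ 0ℤ
    a₀≡0 = ℤP.neg-injective (independent cross cross-relation (suc zero))
    first : Fin (ℕ.suc (ℕ.suc d')) → ℤ
    first zero = 1ℤ
    first (suc _) = 0ℤ
    first-relation : lincomb first u ≡ zero^
    first-relation = relation-first-two first (λ _ → refl) λ j →
      cong (λ x → 1ℤ * x + 0ℤ * lookup (u (suc zero)) j) (trans (u₀-const j zero) a₀≡0)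

Diag-not-eventually-periodic : ∀ d' → ¬ EventuallyPeriodic (Diag (ℕ.suc (ℕ.suc d')))
Diag-not-eventually-periodic d' (u , independent , _ , _ , E , periodic) =
  constant-generators-dependent u (generator-constant zero) (generator-constant (suc zero)) independent
  where
  fresh : Σ ℕ λ n → replicate _ (+ ℕ.suc n) ∉ E
  fresh = ∃-replicate-∉ E
  c : ℤ
  c = + ℕ.suc (proj₁ fresh)
  translate∈𝒟 : ∀ k i → Diag _ (replicate _ c ⊕ ((+ k) · u i))
  translate∈𝒟 k i = periodic _ (Diag-replicate _ c) (proj₂ fresh) _ (·-generator-∈-cone u i k)
  generator-constant : ∀ i → IsConstant (u i)
  generator-constant i = Diag-translate-rigid c (u i) (λ ()) (translate∈𝒟 1 i) (translate∈𝒟 2 i)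

Hyper-complement : ∀ d i → IsComplement (Hyper d i) (Diag d)
Hyper-complement d i = (zero^ , lookup-zero^ i) , λ z →
  let t = lookup z i in
  z ⊖ replicate d t , replicate d t ,
  lookup-⊖-replicate z , Diag-replicate d t , sym (⊖-⊕-cancel z (replicate d t))
  where
  lookup-⊖-replicate : ∀ z → lookup (z ⊖ replicate d (lookup z i)) i ≡ 0ℤ
  lookup-⊖-replicate z = trans (lookup-⊖ z _ i)
    (trans (cong (λ s → lookup z i - s) (lookup-replicate i _)) (ℤP.+-inverseʳ (lookup z i)))

Hyper-minimal : ∀ d i (M : Subset d) → M ⊆ Hyper d i → (Σ (ℤ^ d) λ x → Hyper d i x × ¬ M x) →
  ¬ IsComplement M (Diag d)
Hyper-minimal d i M M⊆ℋᵢ (x , xᵢ≡0 , x∉M) (_ , covers) with covers x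
... | m , δ , m∈M , δ∈𝒟 , x≡m⊕δ = x∉M (subst M (sym x≡m) m∈M)
  where
  open ≡-Reasoning
  δᵢ≡0 : lookup δ i ≡ 0ℤ
  δᵢ≡0 = begin
    lookup δ i              ≡⟨ ℤP.+-identityˡ _ ⟨
    0ℤ + lookup δ i         ≡⟨ cong (_+ lookup δ i) (M⊆ℋᵢ m m∈M) ⟨
    lookup m i + lookup δ i ≡⟨ lookup-⊕ m δ i ⟨
    lookup (m ⊕ δ) i        ≡⟨ cong (λ v → lookup v i) x≡m⊕δ ⟨
    lookup x i              ≡⟨ xᵢ≡0 ⟩
    0ℤ                      ∎
  x≡m : x ≡ m
  x≡m = begin
    x          ≡⟨ x≡m⊕δ ⟩
    m ⊕ δ      ≡⟨ cong (m ⊕_) (Diag-lookup≡0⇒≡zero^ i δ∈𝒟 δᵢ≡0) ⟩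
    m ⊕ zero^  ≡⟨ ⊕-identityʳ m ⟩
    m          ∎

proposition6p1 : (d : ℕ) → d ≥ 2 →
    (¬ EventuallyPeriodic (Diag d)) × (∀ (i : Fin d) → IsMinimalComplement (Hyper d i) (Diag d))
proposition6p1 (ℕ.suc (ℕ.suc d')) (s≤s (s≤s _)) =
  Diag-not-eventually-periodic d' , λ i → Hyper-complement _ i , Hyper-minimal _ i
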